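{- Let $\mathbf P=(P,\le,0,1)$ be a bounded poset with $0\neq 1$, and let $A,B\in D(\mathbf P)$. Then the following are equivalent: (i) $A\perp_{\mathbf D(\mathbf P)}B$, i.e. $LU(A\cup B)=P$ and $A\cap B=\{0\}$; (ii) the supremum $\bigvee_{\mathbf P}(A\cup B)$ exists in $\mathbf P$ and equals $1$, and for all $x\in A$ and all $y\in B$ the infimum $x\wedge y$ exists in $\mathbf P$ and equals $0$.
   Context: For $X\subseteq P$ let $U(X)=\{z\in P\mid x\le z\text{ for all }x\in X\}$, $L(X)=\{z\in P\mid z\le x\text{ for all }x\in X\}$, and $LU(X)=L(U(X))$. The Dedekind–MacNeille completion is $\mathbf D(\mathbf P)=(D(\mathbf P),\subseteq)$ where $D(\mathbf P)=\{L(X)\mid X\subseteq P\}=\{X\subseteq P\mid LU(X)=X\}$; it is a complete lattice with joins $\bigvee_i A_i=LU(\bigcup_i A_i)$ and meets $\bigwedge_i A_i=\bigcap_i A_i$, least element $L(0)=\{0\}$ and greatest element $L(1)=P$. In a bounded lattice or poset, two elements $a,b$ are orthogonal ($a\perp b$) if $a\vee b$ exists and equals the greatest element and $a\wedge b$ exists and equals the least element; so $A\perp_{\mathbf D(\mathbf P)}B$ means $A\vee B=P$ and $A\wedge B=\{0\}$ in $\mathbf D(\mathbf P)$. -}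

module Defs where

open import Level using (Level; _⊔_; suc)
open import Data.Product using (Σ; _×_; _,_)
open import Data.Sum using (_⊎_)
open import Relation.Nullary using (¬_)
open import Relation.Binary.Bundles using (Poset)

record BoundedPoset (c ℓ₁ ℓ₂ : Level) : Set (suc (c ⊔ ℓ₁ ⊔ ℓ₂)) where
  field
    poset : Poset c ℓ₁ ℓ₂
  open Poset poset public
  field
    ⊥ₚ : Carrier
    ⊤ₚ : Carrier
    ⊥ₚ-min : ∀ x → ⊥ₚ ≤ x
    ⊤ₚ-max : ∀ x → x ≤ ⊤ₚ

module _ {c ℓ₁ ℓ₂ : Level} (𝐏 : BoundedPoset c ℓ₁ ℓ₂) where
  open BoundedPoset 𝐏

  Subset : (ℓ : Level) → Set (c ⊔ suc ℓ)
  Subset ℓ = Carrier → Set ℓ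

  U : ∀ {ℓ} → Subset ℓ → Subset (c ⊔ ℓ ⊔ ℓ₂)
  U X z = ∀ x → X x → x ≤ z

  L : ∀ {ℓ} → Subset ℓ → Subset (c ⊔ ℓ ⊔ ℓ₂)
  L X z = ∀ x → X x → z ≤ x

  LU : ∀ {ℓ} → Subset ℓ → Subset (c ⊔ ℓ ⊔ ℓ₂)
  LU X = L (U X)

  _∪_ : ∀ {ℓ} → Subset ℓ → Subset ℓ → Subset ℓ
  (X ∪ Y) z = X z ⊎ Y z

  _∩_ : ∀ {ℓ} → Subset ℓ → Subset ℓ → Subset ℓ
  (X ∩ Y) z = X z × Y z

  _≐_ : ∀ {ℓ ℓ'} → Subset ℓ → Subset ℓ' → Set (c ⊔ ℓ ⊔ ℓ')
  X ≐ Y = (∀ z → X z → Y z) × (∀ z → Y z → X z)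

  Whole : Subset Level.zero
  Whole _ = Data.Unit.⊤
    where import Data.Unit

  Singleton : Carrier → Subset ℓ₁
  Singleton a z = z ≈ a

  InD : ∀ {ℓ} → Subset ℓ → Set (c ⊔ ℓ ⊔ ℓ₂)
  InD X = LU X ≐ X

  -- A ⊥ B in D(P): A ∨ B = LU(A ∪ B) = P and A ∧ B = A ∩ B = {0}
  OrthD : ∀ {ℓ} → Subset ℓ → Subset ℓ → Set (c ⊔ ℓ ⊔ ℓ₁ ⊔ ℓ₂)
  OrthD A B = (LU (A ∪ B) ≐ Whole) × ((A ∩ B) ≐ Singleton ⊥ₚ)

  IsSup : ∀ {ℓ} → Subset ℓ → Carrier → Set (c ⊔ ℓ ⊔ ℓ₂)
  IsSup X s = U X s × (∀ z → U X z → s ≤ z)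

  IsMeet : Carrier → Carrier → Carrier → Set (c ⊔ ℓ₂)
  IsMeet x y m = (m ≤ x × m ≤ y) × (∀ z → z ≤ x → z ≤ y → z ≤ m)

  CondII : ∀ {ℓ} → Subset ℓ → Subset ℓ → Set (c ⊔ ℓ ⊔ ℓ₁ ⊔ ℓ₂)
  CondII A B =
    (Σ Carrier λ s → IsSup (A ∪ B) s × s ≈ ⊤ₚ)
    × (∀ x y → A x → B y → Σ Carrier λ m → IsMeet x y m × m ≈ ⊥ₚ)

module Submission where

open import Defs
open import Level using (Level; _⊔_)
open import Relation.Nullary using (¬_)
open import Function.Bundles using (_⇔_; mk⇔)
open import Data.Product using (Σ; _×_; _,_; proj₁; proj₂)
open import Data.Unit using (tt)

-- A normal ideal is a down-set containing 0.  Hence a common lower bound of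
-- x ∈ A and y ∈ B lies in A ∩ B = {0}, making 0 = x ∧ y; conversely z ∈ A ∩ B
-- gives z ≤ z ∧ z = 0.  And LU(A ∪ B) = P says exactly that 1 lies below every
-- upper bound of A ∪ B, i.e. 1 = ⋁(A ∪ B).

module _ {c ℓ₁ ℓ₂ : Level} (𝐏 : BoundedPoset c ℓ₁ ℓ₂) where
  open BoundedPoset 𝐏
  private
    _≐ᴾ_ : ∀ {ℓ ℓ'} → Subset 𝐏 ℓ → Subset 𝐏 ℓ' → Set (c ⊔ ℓ ⊔ ℓ')
    _≐ᴾ_ = _≐_ 𝐏

    _∩ᴾ_ : ∀ {ℓ} → Subset 𝐏 ℓ → Subset 𝐏 ℓ → Subset 𝐏 ℓ
    _∩ᴾ_ = _∩_ 𝐏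

  InD⇒downClosed : ∀ {ℓ} {X : Subset 𝐏 ℓ} → InD 𝐏 X → ∀ {z x} → z ≤ x → X x → X z
  InD⇒downClosed dX {z} z≤x Xx = proj₁ dX z (λ u Uu → trans z≤x (Uu _ Xx))

  InD⇒⊥∈ : ∀ {ℓ} {X : Subset 𝐏 ℓ} → InD 𝐏 X → ∀ {z} → z ≈ ⊥ₚ → X z
  InD⇒⊥∈ dX {z} z≈⊥ = proj₁ dX z (λ u _ → trans (reflexive z≈⊥) (⊥ₚ-min u))

  LU≐Whole⇒IsSup⊤ : ∀ {ℓ} {X : Subset 𝐏 ℓ} → LU 𝐏 X ≐ᴾ Whole 𝐏 → IsSup 𝐏 X ⊤ₚ
  LU≐Whole⇒IsSup⊤ (_ , ⊆LU) = (λ x _ → ⊤ₚ-max x) , ⊆LU ⊤ₚ tt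

  IsSup⊤⇒LU≐Whole : ∀ {ℓ} {X : Subset 𝐏 ℓ} {s} → IsSup 𝐏 X s → s ≈ ⊤ₚ
                  → LU 𝐏 X ≐ᴾ Whole 𝐏
  IsSup⊤⇒LU≐Whole (_ , least) s≈⊤ =
    (λ _ _ → tt) ,
    (λ z _ u Uu → trans (⊤ₚ-max z) (trans (reflexive (Eq.sym s≈⊤)) (least u Uu)))

  ∩≐⊥⇒IsMeet⊥ : ∀ {ℓ} {A B : Subset 𝐏 ℓ} → InD 𝐏 A → InD 𝐏 B
              → (A ∩ᴾ B) ≐ᴾ Singleton 𝐏 ⊥ₚ
              → ∀ {x y} → A x → B y → IsMeet 𝐏 x y ⊥ₚ
  ∩≐⊥⇒IsMeet⊥ dA dB (A∩B⊆⊥ , _) {x} {y} Ax By =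
    (⊥ₚ-min x , ⊥ₚ-min y) ,
    λ z z≤x z≤y → reflexive (A∩B⊆⊥ z (InD⇒downClosed dA z≤x Ax , InD⇒downClosed dB z≤y By))

  IsMeet⊥⇒∩≐⊥ : ∀ {ℓ} {A B : Subset 𝐏 ℓ} → InD 𝐏 A → InD 𝐏 B
              → (∀ x y → A x → B y → Σ Carrier λ m → IsMeet 𝐏 x y m × m ≈ ⊥ₚ)
              → (A ∩ᴾ B) ≐ᴾ Singleton 𝐏 ⊥ₚ
  IsMeet⊥⇒∩≐⊥ dA dB meets =
    (λ z (Az , Bz) → let (m , (_ , glb) , m≈⊥) = meets z z Az Bz
                     in antisym (trans (glb z refl refl) (reflexive m≈⊥)) (⊥ₚ-min z)) ,
    (λ z z≈⊥ → InD⇒⊥∈ dA z≈⊥ , InD⇒⊥∈ dB z≈⊥)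

theorem5p1 : ∀ {c ℓ₁ ℓ₂ ℓ : Level} (𝐏 : BoundedPoset c ℓ₁ ℓ₂)
    → ¬ (BoundedPoset._≈_ 𝐏 (BoundedPoset.⊥ₚ 𝐏) (BoundedPoset.⊤ₚ 𝐏))
    → (A B : Subset 𝐏 ℓ) → InD 𝐏 A → InD 𝐏 B
    → OrthD 𝐏 A B ⇔ CondII 𝐏 A B
theorem5p1 𝐏 _ A B dA dB = mk⇔ to from
  where
  open BoundedPoset 𝐏 using (⊤ₚ; ⊥ₚ; module Eq)

  to : OrthD 𝐏 A B → CondII 𝐏 A B
  to (LU≐P , A∩B≐⊥) =
    (⊤ₚ , LU≐Whole⇒IsSup⊤ 𝐏 LU≐P , Eq.refl) ,
    (λ x y Ax By → ⊥ₚ , ∩≐⊥⇒IsMeet⊥ 𝐏 dA dB A∩B≐⊥ Ax By , Eq.refl)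

  from : CondII 𝐏 A B → OrthD 𝐏 A B
  from ((s , sup , s≈⊤) , meets) =
    IsSup⊤⇒LU≐Whole 𝐏 sup s≈⊤ , IsMeet⊥⇒∩≐⊥ 𝐏 dA dB meets
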